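{- For every integer $n \ge 5$ such that $n = 3k + 2$ for some integer $k$, there exists an NFA with $n$ states over an alphabet of $2$ letters that admits a mortal word and whose shortest mortal word has length at least $2^{(n-2)/3}$.
   Context: An NFA (nondeterministic finite semi-automaton, with no initial or final states) is a triple $(Q, \Sigma, \Delta)$ where $Q$ is a finite set of states, $\Sigma$ is a finite alphabet, and $\Delta: Q \times \Sigma \to 2^Q$ is a transition relation; possibly $\Delta(q,a) = \emptyset$. Write $q \cdot a = \Delta(q,a)$, extend to words by $q \cdot \varepsilon = \{q\}$ and $q \cdot (wa) = \bigcup_{p \in q \cdot w} p \cdot a$, and to sets $S \subseteq Q$ by $S \cdot w = \bigcup_{q \in S} q \cdot w$. A word $w \in \Sigma^*$ is mortal for the NFA if $Q \cdot w = \emptyset$. The number of states is $|Q|$. -}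

module Defs where

open import Data.Nat using (ℕ)
open import Data.Fin using (Fin)
open import Data.Bool using (Bool; true)
open import Data.List using (List; []; _∷_; length)
open import Data.Product using (∃)
open import Relation.Binary.PropositionalEquality using (_≡_)
open import Relation.Nullary using (¬_)

-- The transition relation
-- Δ : Q × Σ → 2^Q is given by its characteristic function:
-- p ∈ q · a  iff  δ q a p ≡ true.  (Δ(q,a) may be empty.)
record NFA (n m : ℕ) : Set where
  field
    δ : Fin n → Fin m → Fin n → Bool

open NFA public

data _∋_·_↦_ {n m : ℕ} (A : NFA n m) : Fin n → List (Fin m) → Fin n → Set where
  ε-step : ∀ {q} → A ∋ q · [] ↦ q
  a-step : ∀ {q r p a w} → δ A q a r ≡ true → A ∋ r · w ↦ p → A ∋ q · (a ∷ w) ↦ p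

Mortal : ∀ {n m} → NFA n m → List (Fin m) → Set
Mortal A w = ∀ q p → ¬ (A ∋ q · w ↦ p)

ShortestMortalAtLeast : ∀ {n m} → NFA n m → ℕ → Set
ShortestMortalAtLeast A L =
  ∃ (λ w → Mortal A w) × (∀ w → Mortal A w → L Data.Nat.≤ length w)
  where open import Data.Product using (_×_)

-- States O p and I p (0 ≤ p ≤ k) hold the bit 0 or 1 at position p of a binary counter, and k
-- further carry states implement borrows. Letter b shifts every cell one position up; O k dies and
-- I k resets, i.e. moves to every state of the all-ones counter I 1, …, I k. So after b^(k+1) only
-- reset states survive; the word countdown k, made of the words a^(i+1) b^(i+1) that decrement a
-- counter whose lowest set bit sits at position i + 1, turns each I p into O p; and b^k kills O p.
-- For the lower bound, configurations (sets of states read as counters, with potential one more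
-- than the counter value) are pulled back along letters: for each configuration and letter there
-- is a configuration of potential at most one smaller all of whose states are reached from the
-- first by that letter, a reset giving back the all-ones configuration of potential 2^k. Starting
-- from that configuration, every word shorter than 2^k has a run, so it is not mortal.
module Submission where

open import Defs
open import Data.Bool using (Bool; true; false; if_then_else_) renaming (_≟_ to _≟ᵇ_)
open import Data.Empty using (⊥; ⊥-elim)
open import Data.Fin as Fin using (Fin; toℕ; fromℕ<; splitAt; join)
open import Data.Fin.Properties using (toℕ-fromℕ<; toℕ<n; splitAt-join)
open import Data.List using (List; []; _∷_; length; _++_; replicate; _∷ʳ_; initLast; _∷ʳ′_)
open import Data.List.Properties using (length-++; length-replicate)
open import Data.Nat
  using (ℕ; zero; suc; _+_; _*_; _^_; _∸_; _≤_; _<_; z≤n; s≤s; z<s; _≟_; _<?_; _≤?_)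
open import Data.Nat.Properties
open import Data.Nat.Tactic.RingSolver using (solve-∀)
open import Data.Product using (Σ; ∃; _×_; _,_; proj₁; map₁; map₂)
open import Data.Sum using (_⊎_; inj₁; inj₂; [_,_]′)
open import Function using (_∘_)
open import Relation.Binary.PropositionalEquality
open import Relation.Nullary using (¬_; Dec; yes; no; does)
open import Relation.Nullary.Decidable using (dec-true; dec-false; map′; _×-dec_)

↦-++⁻ : ∀ {n m} {A : NFA n m} {q p} u {v} →
        A ∋ q · (u ++ v) ↦ p → ∃ λ r → A ∋ q · u ↦ r × A ∋ r · v ↦ p
↦-++⁻ []      path               = _ , ε-step , path
↦-++⁻ (_ ∷ u) (a-step edge path) with ↦-++⁻ u path
... | r , left , right = r , a-step edge left , right

module PotentialLowerBound
  {n m} (A : NFA n m) {C : Set} (Live : C → Fin n → Set) (pot : C → ℕ)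
  (inhabited : ∀ c → 0 < pot c → ∃ (Live c))
  (step : ∀ c x → ∃ λ c′ → pot c ≤ suc (pot c′) ×
                    (∀ {q′} → Live c′ q′ → ∃ λ q → Live c q × δ A q x q′ ≡ true))
  where

  survives : ∀ c w → length w < pot c → ∃ λ q → Live c q × ∃ (A ∋ q · w ↦_)
  survives c [] 0<pot with inhabited c 0<pot
  ... | q , live = q , live , q , ε-step
  survives c (x ∷ w) len<pot with step c x
  ... | c′ , pot≤ , back with survives c′ w (≤-pred (≤-trans len<pot pot≤))
  ... | q′ , live′ , p , path with back live′
  ... | q , live , edge = q , live , p , a-step edge path

  pot≤mortal : ∀ c w → Mortal A w → pot c ≤ length w
  pot≤mortal c w mortal with length w <? pot c
  ... | no  len≮pot = ≮⇒≥ len≮pot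
  ... | yes len<pot with survives c w len<pot
  ...   | q , _ , p , path = ⊥-elim (mortal q p path)

if-yes : ∀ {P A : Set} (d : Dec P) {x y : A} → P → (if does d then x else y) ≡ x
if-yes d p rewrite dec-true d p = refl

if-no : ∀ {P A : Set} (d : Dec P) {x y : A} → ¬ P → (if does d then x else y) ≡ y
if-no d ¬p rewrite dec-false d ¬p = refl

does-true : ∀ {P : Set} (d : Dec P) → does d ≡ true → P
does-true (yes p) _ = p

replicate-+ : ∀ {X : Set} m n (x : X) → replicate (m + n) x ≡ replicate m x ++ replicate n x
replicate-+ zero    n x = refl
replicate-+ (suc m) n x = cong (x ∷_) (replicate-+ m n x)

length-∷ʳ : ∀ {X : Set} (xs : List X) x → length (xs ∷ʳ x) ≡ suc (length xs)
length-∷ʳ xs x = trans (length-++ xs) (+-comm (length xs) 1)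

<⇒∃suc+ : ∀ {m n} → m < n → ∃ λ d → n ≡ suc d + m
<⇒∃suc+ {m} m<n with m≤n⇒∃[o]m+o≡n m<n
... | d , refl = d , cong suc (+-comm m d)

data State : Set where
  cell  : Bool → ℕ → State
  carry : ℕ → State

pattern O p = cell false p
pattern I p = cell true p

_≟ˢ_ : (s t : State) → Dec (s ≡ t)
cell x p ≟ˢ cell y q with x ≟ᵇ y
... | no  x≢y  = no λ { refl → x≢y refl }
... | yes refl = map′ (cong (cell x)) (λ { refl → refl }) (p ≟ q)
carry p  ≟ˢ carry q  = map′ (cong carry) (λ { refl → refl }) (p ≟ q)
cell _ _ ≟ˢ carry _  = no λ ()
carry _  ≟ˢ cell _ _ = no λ ()

data Move : Set where
  goto  : State → Move
  reset : Move
  die   : Move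

Word : Set
Word = List (Fin 2)

pattern a = Fin.zero
pattern b = Fin.suc Fin.zero

size : ℕ → ℕ
size k = suc k + (suc k + k)

module Counter (k : ℕ) where

  moveA : State → Move
  moveA (cell x (suc p)) = goto (cell x p)
  moveA (O 0)            = if does (2 ≤? k) then goto (carry 1) else reset
  moveA (I 0)            = reset
  moveA (carry 0)        = reset
  moveA (carry (suc q))  = if does (suc (suc q) <? k) then goto (carry (suc (suc q))) else reset

  moveB : State → Move
  moveB (O p)           = if does (p <? k) then goto (O (suc p)) else die
  moveB (I 0)           = goto (O 1)
  moveB (I (suc p))     = if does (suc p <? k) then goto (I (suc (suc p))) else reset
  moveB (carry 0)       = goto (I 1)
  moveB (carry (suc q)) = goto (carry q)

  move : State → Fin 2 → Move
  move s a = moveA s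
  move s b = moveB s

  Reset : State → Set
  Reset (I p) = 1 ≤ p × p ≤ k
  Reset _     = ⊥

  reset? : ∀ s → Dec (Reset s)
  reset? (I p)     = (1 ≤? p) ×-dec (p ≤? k)
  reset? (O _)     = no λ ()
  reset? (carry _) = no λ ()

  data Edge (s : State) (x : Fin 2) : State → Set where
    goto-edge  : ∀ {t} → move s x ≡ goto t → Edge s x t
    reset-edge : ∀ {t} → move s x ≡ reset → Reset t → Edge s x t

  goto-edge-unique : ∀ {s x t t′} → move s x ≡ goto t → Edge s x t′ → t′ ≡ t
  goto-edge-unique eq (goto-edge eq′) with trans (sym eq) eq′
  ... | refl = refl
  goto-edge-unique eq (reset-edge eq′ _) with trans (sym eq) eq′
  ... | ()

  reset-edge-inv : ∀ {s x t} → move s x ≡ reset → Edge s x t → Reset t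
  reset-edge-inv eq (reset-edge _ r) = r
  reset-edge-inv eq (goto-edge eq′) with trans (sym eq) eq′
  ... | ()

  no-edge-if-dies : ∀ {s x t} → move s x ≡ die → ¬ Edge s x t
  no-edge-if-dies eq (goto-edge eq′) with trans (sym eq) eq′
  ... | ()
  no-edge-if-dies eq (reset-edge eq′ _) with trans (sym eq) eq′
  ... | ()

  edge? : ∀ s x t → Dec (Edge s x t)
  edge? s x t with move s x in eq
  ... | goto t′ = map′ (λ { refl → goto-edge eq }) (sym ∘ goto-edge-unique eq) (t′ ≟ˢ t)
  ... | reset   = map′ (reset-edge eq) (reset-edge-inv eq) (reset? t)
  ... | die     = no (no-edge-if-dies eq)

  Valid : State → Set
  Valid (cell _ p) = p ≤ k
  Valid (carry q)  = q < k

  decode : Fin (size k) → State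
  decode i = [ O ∘ toℕ , [ I ∘ toℕ , carry ∘ toℕ ]′ ∘ splitAt (suc k) ]′ (splitAt (suc k) i)

  encode : ∀ s → Valid s → Fin (size k)
  encode (O p)     v = join (suc k) _ (inj₁ (fromℕ< (s≤s v)))
  encode (I p)     v = join (suc k) _ (inj₂ (join (suc k) k (inj₁ (fromℕ< (s≤s v)))))
  encode (carry q) v = join (suc k) _ (inj₂ (join (suc k) k (inj₂ (fromℕ< v))))

  decode-encode : ∀ s v → decode (encode s v) ≡ s
  decode-encode (O p) v
    rewrite splitAt-join (suc k) (suc k + k) (inj₁ (fromℕ< (s≤s v))) = cong O (toℕ-fromℕ< _)
  decode-encode (I p) v
    rewrite splitAt-join (suc k) (suc k + k) (inj₂ (join (suc k) k (inj₁ (fromℕ< (s≤s v)))))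
          | splitAt-join (suc k) k (inj₁ (fromℕ< (s≤s v))) = cong I (toℕ-fromℕ< _)
  decode-encode (carry q) v
    rewrite splitAt-join (suc k) (suc k + k) (inj₂ (join (suc k) k (inj₂ (fromℕ< v))))
          | splitAt-join (suc k) k (inj₂ (fromℕ< v)) = cong carry (toℕ-fromℕ< _)

  encode-valid : ∀ {s} → Valid s → ∃ λ q → decode q ≡ s
  encode-valid {s} v = encode s v , decode-encode s v

  decode-valid : ∀ i → Valid (decode i)
  decode-valid i with splitAt (suc k) i
  ... | inj₁ j = ≤-pred (toℕ<n j)
  ... | inj₂ i′ with splitAt (suc k) i′
  ...   | inj₁ j = ≤-pred (toℕ<n j)
  ...   | inj₂ j = toℕ<n j

  automaton : NFA (size k) 2
  automaton = record { δ = λ i x j → does (edge? (decode i) x (decode j)) }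

  δ⇒edge : ∀ q x r → δ automaton q x r ≡ true → Edge (decode q) x (decode r)
  δ⇒edge q x r = does-true (edge? (decode q) x (decode r))

  edge⇒δ : ∀ q x r → Edge (decode q) x (decode r) → δ automaton q x r ≡ true
  edge⇒δ q x r = dec-true (edge? (decode q) x (decode r))

  _⊢_↦_ : Fin (size k) → Word → Fin (size k) → Set
  q ⊢ w ↦ p = automaton ∋ q · w ↦ p

  a-O₀ : 2 ≤ k → move (O 0) a ≡ goto (carry 1)
  a-O₀ = if-yes (2 ≤? k)

  a-O₀-reset : ¬ 2 ≤ k → move (O 0) a ≡ reset
  a-O₀-reset = if-no (2 ≤? k)

  a-carry : ∀ {q} → suc (suc q) < k → move (carry (suc q)) a ≡ goto (carry (suc (suc q)))
  a-carry {q} = if-yes (suc (suc q) <? k)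

  a-carry-reset : ∀ {q} → ¬ suc (suc q) < k → move (carry (suc q)) a ≡ reset
  a-carry-reset {q} = if-no (suc (suc q) <? k)

  b-O : ∀ {p} → p < k → move (O p) b ≡ goto (O (suc p))
  b-O {p} = if-yes (p <? k)

  b-O-dies : ∀ {p} → ¬ p < k → move (O p) b ≡ die
  b-O-dies {p} = if-no (p <? k)

  b-I : ∀ {p} → suc p < k → move (I (suc p)) b ≡ goto (I (suc (suc p)))
  b-I {p} = if-yes (suc p <? k)

  b-I-reset : ∀ {p} → ¬ suc p < k → move (I (suc p)) b ≡ reset
  b-I-reset {p} = if-no (suc p <? k)

  b-bottom : ∀ x → 1 ≤ k → move (cell x 0) b ≡ goto (O 1)
  b-bottom false = b-O
  b-bottom true  = λ _ → refl

  b-cell : ∀ x {p} → suc p < k → move (cell x (suc p)) b ≡ goto (cell x (suc (suc p)))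
  b-cell false = b-O
  b-cell true  = b-I

  data _—[_]→_ : State → Word → State → Set where
    []  : ∀ {s} → s —[ [] ]→ s
    _∷_ : ∀ {s x t w r} → move s x ≡ goto t → t —[ w ]→ r → s —[ x ∷ w ]→ r

  data Dies : State → Word → Set where
    here  : ∀ {s x w} → move s x ≡ die → Dies s (x ∷ w)
    there : ∀ {s x t w} → move s x ≡ goto t → Dies t w → Dies s (x ∷ w)

  _++→_ : ∀ {s t r u v} → s —[ u ]→ t → t —[ v ]→ r → s —[ u ++ v ]→ r
  []           ++→ t→r = t→r
  (step ∷ s→t) ++→ t→r = step ∷ (s→t ++→ t→r)

  _++✝_ : ∀ {s t u v} → s —[ u ]→ t → Dies t v → Dies s (u ++ v)
  []           ++✝ dies = dies
  (step ∷ s→t) ++✝ dies = there step (s→t ++✝ dies)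

  —→-sound : ∀ {q p s w t} → decode q ≡ s → s —[ w ]→ t → q ⊢ w ↦ p → decode p ≡ t
  —→-sound refl []            ε-step = refl
  —→-sound {q} refl (step ∷ rest) (a-step {r = r} {a = x} e path) =
    —→-sound (goto-edge-unique step (δ⇒edge q x r e)) rest path

  Dies-sound : ∀ {q p s w} → decode q ≡ s → Dies s w → ¬ q ⊢ w ↦ p
  Dies-sound {q} refl (here step) (a-step {r = r} {a = x} e _) =
    no-edge-if-dies step (δ⇒edge q x r e)
  Dies-sound {q} refl (there step rest) (a-step {r = r} {a = x} e path) =
    Dies-sound (goto-edge-unique step (δ⇒edge q x r e)) rest path

  a-cells : ∀ x p m → cell x (p + m) —[ replicate m a ]→ cell x p
  a-cells x p zero    rewrite +-identityʳ p = []
  a-cells x p (suc m) rewrite +-suc p m     = refl ∷ a-cells x p m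

  b-cells : ∀ x p m → suc p + m ≤ k → cell x (suc p) —[ replicate m b ]→ cell x (suc p + m)
  b-cells x p zero    _ rewrite +-identityʳ p = []
  b-cells x p (suc m) h rewrite +-suc (suc p) m =
    b-cell x (≤-trans (s≤s (s≤s (m≤m+n p m))) h) ∷ b-cells x (suc p) m h

  a-carries : ∀ q m → suc q + m < k → carry (suc q) —[ replicate m a ]→ carry (suc q + m)
  a-carries q zero    _ rewrite +-identityʳ q = []
  a-carries q (suc m) h rewrite +-suc (suc q) m =
    a-carry (≤-trans (s≤s (s≤s (s≤s (m≤m+n q m)))) h) ∷ a-carries (suc q) m h

  b-carry-to-I₁ : ∀ q → carry q —[ replicate (suc q) b ]→ I 1
  b-carry-to-I₁ zero    = refl ∷ []
  b-carry-to-I₁ (suc q) = refl ∷ b-carry-to-I₁ q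

  O-dies : ∀ p m → p ≤ k → k < p + m → Dies (O p) (replicate m b)
  O-dies p zero    p≤k k<p = ⊥-elim (<⇒≱ k<p (subst (_≤ k) (sym (+-identityʳ p)) p≤k))
  O-dies p (suc m) p≤k k<p with p <? k
  ... | yes p<k = there (b-O p<k) (O-dies (suc p) m p<k (subst (k <_) (+-suc p m) k<p))
  ... | no  p≮k = here (b-O-dies p≮k)

  flip : ℕ → Word
  flip i = replicate (suc i) a ++ replicate (suc i) b

  flip-above : ∀ x i p → suc i < p → p ≤ k → cell x p —[ flip i ]→ cell x p
  flip-above x i p 1+i<p p≤k with <⇒∃suc+ 1+i<p
  ... | d , refl = a-cells x (suc d) (suc i) ++→ b-cells x d (suc i) p≤k

  flip-top : ∀ i → i < k → I (suc i) —[ flip i ]→ O (suc i)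
  flip-top i i<k = a-cells true 0 (suc i) ++→ (refl ∷ b-cells false 0 i i<k)

  -- O (suc j) reaches O 0, becomes carry 1 and climbs during the remaining a's; the b's bring it
  -- down to carry 0, then to I 1 and up to I (suc j).
  flip-below : ∀ j i → j < i → i < k → O (suc j) —[ flip i ]→ I (suc j)
  flip-below j i j<i i<k with <⇒∃suc+ j<i
  ... | d , refl = subst (O (suc j) —[_]→ carry (suc d)) a-split climb ++→ descend
    where
    climb : O (suc j) —[ replicate (suc j) a ++ replicate (suc d) a ]→ carry (suc d)
    climb = a-cells false 0 (suc j) ++→
            (a-O₀ (≤-trans (s≤s (s≤s z≤n)) i<k) ∷
             a-carries 0 d (≤-trans (s≤s (s≤s (m≤m+n d j))) i<k))

    a-split : replicate (suc j) a ++ replicate (suc d) a ≡ replicate (suc (suc (d + j))) a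
    a-split = trans (sym (replicate-+ (suc j) (suc d) a))
                    (cong (λ n → replicate (suc n) a) (trans (+-suc j d) (cong suc (+-comm j d))))

    descend : carry (suc d) —[ replicate (suc (suc (d + j))) b ]→ I (suc j)
    descend = subst (carry (suc d) —[_]→ I (suc j)) (sym (replicate-+ (suc (suc d)) j b))
                    (b-carry-to-I₁ (suc d) ++→
                     b-cells true 0 j (≤-trans (s≤s (m≤n+m j d)) (<⇒≤ i<k)))

  countdown : ℕ → Word
  countdown zero    = []
  countdown (suc m) = countdown m ++ flip m ++ countdown m

  countdown-above : ∀ x m j → m ≤ j → j < k → cell x (suc j) —[ countdown m ]→ cell x (suc j)
  countdown-above x zero    j _   _   = []
  countdown-above x (suc m) j m<j j<k = fixed ++→ (flip-above x m (suc j) (s≤s m<j) j<k ++→ fixed)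
    where
    fixed : cell x (suc j) —[ countdown m ]→ cell x (suc j)
    fixed = countdown-above x m j (<⇒≤ m<j) j<k

  countdown-below : ∀ m j → j < m → m ≤ k → I (suc j) —[ countdown m ]→ O (suc j)
  countdown-below (suc m) j j<1+m m<k with m≤n⇒m<n∨m≡n (≤-pred j<1+m)
  ... | inj₂ refl = countdown-above true m m ≤-refl m<k ++→
                    (flip-top m m<k ++→ countdown-above false m m ≤-refl m<k)
  ... | inj₁ j<m  = below ++→ (flip-below j m j<m m<k ++→ below)
    where
    below : I (suc j) —[ countdown m ]→ O (suc j)
    below = countdown-below m j j<m (<⇒≤ m<k)

  Reset-b : ∀ {s t} → Reset s → Edge s b t → Reset t
  Reset-b {I (suc p)} _ e with suc p <? k
  ... | yes 1+p<k = subst Reset (sym (goto-edge-unique (b-I 1+p<k) e)) (s≤s z≤n , 1+p<k)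
  ... | no  1+p≮k = reset-edge-inv (b-I-reset 1+p≮k) e

  Reset-bs : ∀ {q r} m → Reset (decode q) → q ⊢ replicate m b ↦ r → Reset (decode r)
  Reset-bs zero        q∈R ε-step = q∈R
  Reset-bs {q} (suc m) q∈R (a-step {r = r} e path) = Reset-bs m (Reset-b q∈R (δ⇒edge q b r e)) path

  b^[1+k]-resets : 1 ≤ k → ∀ {q r} → q ⊢ replicate (suc k) b ↦ r → Reset (decode r)
  b^[1+k]-resets 1≤k {q} {r} path with decode q in eq | decode-valid q
  ... | O p       | p≤k = ⊥-elim (Dies-sound eq (O-dies p (suc k) p≤k (m≤n+m (suc k) p)) path)
  ... | I 0       | _   = ⊥-elim (Dies-sound eq (there refl (O-dies 1 k 1≤k ≤-refl)) path)
  ... | I (suc p) | p<k = Reset-bs (suc k) (subst Reset (sym eq) (s≤s z≤n , p<k)) path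
  ... | carry n   | n<k with ↦-++⁻ (replicate (suc n) b) (subst (λ w → q ⊢ w ↦ r) split path)
    where
    split : replicate (suc k) b ≡ replicate (suc n) b ++ replicate (k ∸ n) b
    split = trans (cong (λ m → replicate (suc m) b) (sym (m+[n∸m]≡n (<⇒≤ n<k))))
                  (replicate-+ (suc n) (k ∸ n) b)
  ...   | _ , to-I₁ , rest =
    Reset-bs (k ∸ n) (subst Reset (sym (—→-sound eq (b-carry-to-I₁ n) to-I₁)) (≤-refl , 1≤k)) rest

  mortalWord : Word
  mortalWord = replicate (suc k) b ++ countdown k ++ replicate k b

  mortalWord-mortal : 1 ≤ k → Mortal automaton mortalWord
  mortalWord-mortal 1≤k q p path with ↦-++⁻ (replicate (suc k) b) path
  ... | r , reach , rest with decode r in eq | b^[1+k]-resets 1≤k reach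
  ... | I (suc j) | _ , j<k =
    Dies-sound eq (countdown-below k j j<k ≤-refl ++✝ O-dies (suc j) k j<k (s≤s (m≤n+m k j))) rest

bit : Bool → ℕ
bit false = 0
bit true  = 1

bit≤1 : ∀ x → bit x ≤ 1
bit≤1 false = z≤n
bit≤1 true  = ≤-refl

value : List Bool → ℕ
value []       = 0
value (x ∷ xs) = bit x + 2 * value xs

1+value-ones : ∀ m → suc (value (replicate m true)) ≡ 2 ^ m
1+value-ones zero    = refl
1+value-ones (suc m) = trans (sym (*-suc 2 (value (replicate m true)))) (cong (2 *_) (1+value-ones m))

value<2^length : ∀ xs → value xs < 2 ^ length xs
value<2^length []       = s≤s z≤n
value<2^length (x ∷ xs) = begin
  suc (bit x + 2 * value xs)  ≤⟨ s≤s (+-monoˡ-≤ (2 * value xs) (bit≤1 x)) ⟩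
  2 + 2 * value xs            ≡⟨ *-suc 2 (value xs) ⟨
  2 * suc (value xs)          ≤⟨ *-monoʳ-≤ 2 (value<2^length xs) ⟩
  2 * 2 ^ length xs           ∎
  where open ≤-Reasoning

value-∷ʳ-false : ∀ xs → value (xs ∷ʳ false) ≡ value xs
value-∷ʳ-false []       = refl
value-∷ʳ-false (x ∷ xs) = cong (λ v → bit x + 2 * v) (value-∷ʳ-false xs)

InCells : ℕ → List Bool → State → Set
InCells e []       s = ⊥
InCells e (x ∷ xs) s = s ≡ cell x e ⊎ InCells (suc e) xs s

InCarries : ℕ → ℕ → State → Set
InCarries l n s = ∃ λ i → i < n × s ≡ carry (l + i)

data Config : Set where
  cells    : ℕ → List Bool → Config
  climbing : ℕ → List Bool → Config
  falling  : ℕ → List Bool → Config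
  carries  : ℕ → ℕ → Config

Mem : Config → State → Set
Mem (cells e xs)    s = InCells e xs s
Mem (climbing r xs) s = InCarries 1 (suc r) s ⊎ InCells 0 xs s
Mem (falling r xs)  s = InCarries 0 (suc r) s ⊎ InCells 1 xs s
Mem (carries r t)   s = InCarries (suc (suc t)) (suc r) s

cellsPot : List Bool → ℕ
cellsPot []         = 0
cellsPot xs@(_ ∷ _) = suc (value xs)

-- The r + 1 carry states of a configuration stand for r + 1 low-order bits of the counter, zeros
-- while they climb under a and ones while they fall under b.
pot : Config → ℕ
pot (cells _ xs)    = cellsPot xs
pot (climbing r xs) = suc (2 ^ suc r * value xs)
pot (falling r xs)  = 2 ^ suc r * suc (value xs)
pot (carries _ _)   = 1

cellsPot-∷ʳ-false : ∀ ys → cellsPot (ys ∷ʳ false) ≤ suc (cellsPot ys)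
cellsPot-∷ʳ-false []       = ≤-refl
cellsPot-∷ʳ-false (y ∷ ys) rewrite value-∷ʳ-false ys = n≤1+n _

InCells-last : ∀ e ys y → InCells e (ys ∷ʳ y) (cell y (e + length ys))
InCells-last e []       y = inj₁ (cong (cell y) (+-identityʳ e))
InCells-last e (x ∷ ys) y = inj₂ (subst (λ p → InCells (suc e) (ys ∷ʳ y) (cell y p))
                                        (sym (+-suc e (length ys))) (InCells-last (suc e) ys y))

InCells-∷ʳ : ∀ {s} e ys y → InCells e ys s → InCells e (ys ∷ʳ y) s
InCells-∷ʳ e (x ∷ ys) y (inj₁ eq) = inj₁ eq
InCells-∷ʳ e (x ∷ ys) y (inj₂ s∈) = inj₂ (InCells-∷ʳ (suc e) ys y s∈)

Mem-inhabited : ∀ c → 0 < pot c → ∃ (Mem c)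
Mem-inhabited (cells e (x ∷ _)) _ = cell x e , inj₁ refl
Mem-inhabited (climbing _ _)    _ = carry 1 , inj₁ (0 , s≤s z≤n , refl)
Mem-inhabited (falling _ _)     _ = carry 0 , inj₁ (0 , s≤s z≤n , refl)
Mem-inhabited (carries _ t)     _ = carry (suc (suc t)) , 0 , s≤s z≤n , cong carry (sym (+-identityʳ _))

module CounterLowerBound (k : ℕ) where
  open Counter k

  Fits : Config → Set
  Fits (cells e xs)    = length xs ≤ k × e + length xs ≤ suc k
  Fits (climbing r xs) = suc r + length xs ≤ k × suc r < k
  Fits (falling r xs)  = suc r + length xs ≤ k
  Fits (carries r t)   = suc (suc t) + r < k

  ones : Config
  ones = cells 1 (replicate k true)

  ones-fits : Fits ones
  ones-fits = ≤-reflexive (length-replicate k) , s≤s (≤-reflexive (length-replicate k))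

  pot-ones : 1 ≤ k → pot ones ≡ 2 ^ k
  pot-ones (s≤s _) = 1+value-ones k

  InCells-ones-Reset : ∀ {s} e m → 1 ≤ e → e + m ≤ suc k →
                       InCells e (replicate m true) s → Reset s
  InCells-ones-Reset e (suc m) 1≤e h (inj₁ refl) = 1≤e , ≤-pred (≤-trans (m<m+n e z<s) h)
  InCells-ones-Reset e (suc m) 1≤e h (inj₂ s∈)   =
    InCells-ones-Reset (suc e) m (s≤s z≤n) (subst (_≤ suc k) (+-suc e m) h) s∈

  InCells-valid : ∀ {s} e xs → e + length xs ≤ suc k → InCells e xs s → Valid s
  InCells-valid e (x ∷ xs) h (inj₁ refl) = ≤-pred (≤-trans (m<m+n e z<s) h)
  InCells-valid e (x ∷ xs) h (inj₂ s∈)   =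
    InCells-valid (suc e) xs (subst (_≤ suc k) (+-suc e (length xs)) h) s∈

  Mem-valid : ∀ {s} c → Fits c → Mem c s → Valid s
  Mem-valid (cells e xs)    (_ , h)   s∈                          = InCells-valid e xs h s∈
  Mem-valid (climbing r xs) (_ , r<k) (inj₁ (i , i<1+r , refl)) = ≤-trans (s≤s i<1+r) r<k
  Mem-valid (climbing r xs) (h , _)   (inj₂ s∈)                  =
    InCells-valid 0 xs (≤-trans (m≤n+m (length xs) (suc r)) (≤-trans h (n≤1+n k))) s∈
  Mem-valid (falling r xs)  h (inj₁ (i , i<1+r , refl)) =
    ≤-trans i<1+r (≤-trans (m≤m+n (suc r) (length xs)) h)
  Mem-valid (falling r xs)  h (inj₂ s∈)                  =
    InCells-valid 1 xs (s≤s (≤-trans (m≤n+m (length xs) (suc r)) h)) s∈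
  Mem-valid (carries r t)   h (i , i<1+r , refl) = ≤-<-trans (+-monoʳ-≤ (suc (suc t)) (≤-pred i<1+r)) h

  2^[1+r]*[1+value]≤2^k : ∀ r xs → suc r + length xs ≤ k → 2 ^ suc r * suc (value xs) ≤ 2 ^ k
  2^[1+r]*[1+value]≤2^k r xs h = begin
    2 ^ suc r * suc (value xs)  ≤⟨ *-monoʳ-≤ (2 ^ suc r) (value<2^length xs) ⟩
    2 ^ suc r * 2 ^ length xs   ≡⟨ ^-distribˡ-+-* 2 (suc r) (length xs) ⟨
    2 ^ (suc r + length xs)     ≤⟨ ^-monoʳ-≤ 2 h ⟩
    2 ^ k                       ∎
    where open ≤-Reasoning

  pot≤2^k : ∀ c → Fits c → pot c ≤ 2 ^ k
  pot≤2^k (cells e [])       _       = z≤n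
  pot≤2^k (cells e (x ∷ xs)) (h , _) = ≤-trans (value<2^length (x ∷ xs)) (^-monoʳ-≤ 2 h)
  pot≤2^k (climbing r xs)    (h , _) = begin
    suc (2 ^ suc r * value xs)        ≤⟨ +-monoˡ-≤ _ (m^n>0 2 (suc r)) ⟩
    2 ^ suc r + 2 ^ suc r * value xs  ≡⟨ *-suc (2 ^ suc r) (value xs) ⟨
    2 ^ suc r * suc (value xs)        ≤⟨ 2^[1+r]*[1+value]≤2^k r xs h ⟩
    2 ^ k                             ∎
    where open ≤-Reasoning
  pot≤2^k (falling r xs)     h       = 2^[1+r]*[1+value]≤2^k r xs h
  pot≤2^k (carries _ _)      _       = m^n>0 2 k

  cells-a⁻¹ : ∀ e xs {s′} → InCells e xs s′ → ∃ λ s → InCells (suc e) xs s × Edge s a s′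
  cells-a⁻¹ e (x ∷ xs) (inj₁ refl) = cell x (suc e) , inj₁ refl , goto-edge refl
  cells-a⁻¹ e (x ∷ xs) (inj₂ s′∈)  = map₂ (map₁ inj₂) (cells-a⁻¹ (suc e) xs s′∈)

  cells-b⁻¹ : ∀ e xs {s′} → suc e + length xs ≤ k → InCells (suc (suc e)) xs s′ →
              ∃ λ s → InCells (suc e) xs s × Edge s b s′
  cells-b⁻¹ e (x ∷ xs) h (inj₁ refl) =
    cell x (suc e) , inj₁ refl , goto-edge (b-cell x (<-≤-trans (m<m+n (suc e) z<s) h))
  cells-b⁻¹ e (x ∷ xs) h (inj₂ s′∈) =
    map₂ (map₁ inj₂) (cells-b⁻¹ (suc e) xs (subst (_≤ k) (+-suc (suc e) (length xs)) h) s′∈)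

  carries-a⁻¹ : ∀ l n {s′} → suc (suc l) + n ≤ k → InCarries (suc (suc l)) n s′ →
                ∃ λ s → InCarries (suc l) n s × Edge s a s′
  carries-a⁻¹ l n h (i , i<n , refl) =
    carry (suc l + i) , (i , i<n , refl) , goto-edge (a-carry (≤-trans (s≤s (s≤s (+-monoʳ-< l i<n))) h))

  carries-b⁻¹ : ∀ l n {s′} → InCarries l n s′ → ∃ λ s → InCarries (suc l) n s × Edge s b s′
  carries-b⁻¹ l n (i , i<n , refl) = carry (suc l + i) , (i , i<n , refl) , goto-edge refl

  Back : Config → Fin 2 → Config → Set
  Back c x c′ = ∀ {s′} → Mem c′ s′ → ∃ λ s → Mem c s × Edge s x s′

  record Step (c : Config) (x : Fin 2) : Set where
    constructor step
    field
      next      : Config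
      next-fits : Fits next
      pot≤      : pot c ≤ suc (pot next)
      back      : Back c x next

  reset-step : ∀ {c x s} → 1 ≤ k → Fits c → Mem c s → move s x ≡ reset → Step c x
  reset-step {c} 1≤k fits s∈ eq = step ones ones-fits
    (≤-trans (pot≤2^k c fits) (≤-trans (≤-reflexive (sym (pot-ones 1≤k))) (n≤1+n _)))
    (λ s′∈ → _ , s∈ , reset-edge eq (InCells-ones-Reset 1 k ≤-refl ≤-refl s′∈))

  empty-step : ∀ e x → Step (cells e []) x
  empty-step e x = step (cells 0 []) (z≤n , z≤n) z≤n λ ()

  step-cells-a : ∀ e xs → 1 ≤ k → Fits (cells e xs) → Step (cells e xs) a
  step-cells-a (suc e) xs 1≤k (h , h′) =
    step (cells e xs) (h , ≤-trans (n≤1+n _) h′) (n≤1+n _) λ s′∈ → cells-a⁻¹ e xs s′∈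
  step-cells-a zero [] _ _ = empty-step 0 a
  step-cells-a zero (true ∷ xs)  1≤k fits = reset-step 1≤k fits (inj₁ refl) refl
  step-cells-a zero (false ∷ xs) 1≤k fits with 2 ≤? k
  ... | no  2≰k = reset-step 1≤k fits (inj₁ refl) (a-O₀-reset 2≰k)
  ... | yes 2≤k = step (climbing 0 xs) (proj₁ fits , 2≤k) (n≤1+n _) back
    where
    back : Back (cells 0 (false ∷ xs)) a (climbing 0 xs)
    back (inj₁ (0 , _ , refl))       = O 0 , inj₁ refl , goto-edge (a-O₀ 2≤k)
    back (inj₁ (suc _ , s≤s () , _))
    back (inj₂ s′∈)                  = map₂ (map₁ inj₂) (cells-a⁻¹ 0 xs s′∈)

  overflow-b : ∀ e ys y → 1 ≤ k → Fits (cells (suc e) (ys ∷ʳ y)) → suc e + length ys ≡ k →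
               Step (cells (suc e) (ys ∷ʳ y)) b
  overflow-b e ys true (s≤s _) fits top =
    reset-step (s≤s z≤n) fits
               (subst (λ p → InCells (suc e) (ys ∷ʳ true) (I p)) top (InCells-last (suc e) ys true))
               (b-I-reset (<-irrefl refl))
  overflow-b e ys false 1≤k (h , _) top =
    step (cells (suc (suc e)) ys)
         (≤-trans (n≤1+n _) (subst (_≤ k) (length-∷ʳ ys false) h) , s≤s (≤-reflexive top))
         (cellsPot-∷ʳ-false ys)
         λ s′∈ → map₂ (map₁ (InCells-∷ʳ (suc e) ys false))
                      (cells-b⁻¹ e ys (≤-reflexive top) s′∈)

  step-cells-b : ∀ e xs → 1 ≤ k → Fits (cells e xs) → Step (cells e xs) b
  step-cells-b zero [] _ _ = empty-step 0 b
  step-cells-b zero (x ∷ xs) 1≤k (h , _) = step (cells 1 (false ∷ xs)) (h , s≤s h) (pot≤ x) back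
    where
    pot≤ : ∀ x → cellsPot (x ∷ xs) ≤ suc (cellsPot (false ∷ xs))
    pot≤ false = n≤1+n _
    pot≤ true  = ≤-refl

    back : Back (cells 0 (x ∷ xs)) b (cells 1 (false ∷ xs))
    back (inj₁ refl) = cell x 0 , inj₁ refl , goto-edge (b-bottom x 1≤k)
    back (inj₂ s′∈)  = map₂ (map₁ inj₂) (cells-b⁻¹ 0 xs h s′∈)
  step-cells-b (suc e) xs 1≤k (h , h′) with initLast xs
  ... | [] = empty-step (suc e) b
  ... | ys ∷ʳ′ y with m≤n⇒m<n∨m≡n h′
  ...   | inj₁ fits = step (cells (suc (suc e)) (ys ∷ʳ y)) (h , fits) (n≤1+n _)
                        λ s′∈ → cells-b⁻¹ e (ys ∷ʳ y) (≤-pred fits) s′∈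
  ...   | inj₂ top  = overflow-b e ys y 1≤k (h , h′) top-at-k
    where
    top-at-k : suc e + length ys ≡ k
    top-at-k = suc-injective (trans (sym (+-suc (suc e) (length ys)))
                                    (trans (cong (suc e +_) (sym (length-∷ʳ ys y))) top))

  step-climbing-a : ∀ r xs → 1 ≤ k → Fits (climbing r xs) → Step (climbing r xs) a
  step-climbing-a r xs 1≤k fits with suc (suc r) <? k
  ... | no  2+r≮k = reset-step 1≤k fits (inj₁ (r , ≤-refl , refl)) (a-carry-reset 2+r≮k)
  step-climbing-a r [] 1≤k fits | yes 2+r<k =
    step (carries r 0) 2+r<k (s≤s (≤-trans (≤-reflexive (*-zeroʳ (2 ^ suc r))) z≤n))
         λ s′∈ → map₂ (map₁ inj₁) (carries-a⁻¹ 0 (suc r) 2+r<k s′∈)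
  step-climbing-a r (true ∷ xs)  1≤k fits | yes _ = reset-step 1≤k fits (inj₂ (inj₁ refl)) refl
  step-climbing-a r (false ∷ xs) 1≤k (h , _) | yes 2+r<k =
    step (climbing (suc r) xs) (subst (_≤ k) (+-suc (suc r) (length xs)) h , 2+r<k) pot≤ back
    where
    pot≤ : suc (2 ^ suc r * (2 * value xs)) ≤ suc (suc (2 ^ suc (suc r) * value xs))
    pot≤ = s≤s (≤-trans (≤-reflexive (trans (sym (*-assoc (2 ^ suc r) 2 (value xs)))
                                            (cong (_* value xs) (*-comm (2 ^ suc r) 2))))
                        (n≤1+n _))

    back : Back (climbing r (false ∷ xs)) a (climbing (suc r) xs)
    back (inj₁ (0 , _ , refl)) =
      O 0 , inj₂ (inj₁ refl) , goto-edge (a-O₀ (≤-trans (s≤s (s≤s z≤n)) 2+r<k))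
    back (inj₁ (suc i , s≤s i<1+r , refl)) =
      map₂ (map₁ inj₁) (carries-a⁻¹ 0 (suc r) 2+r<k (i , i<1+r , refl))
    back (inj₂ s′∈) = map₂ (map₁ (inj₂ ∘ inj₂)) (cells-a⁻¹ 0 xs s′∈)

  step-climbing-b : ∀ r xs → 1 ≤ k → Fits (climbing r xs) → Step (climbing r xs) b
  step-climbing-b r [] 1≤k (h , _) =
    step (falling r []) h (s≤s (*-monoʳ-≤ (2 ^ suc r) z≤n))
         λ { (inj₁ s′∈) → map₂ (map₁ inj₁) (carries-b⁻¹ 0 (suc r) s′∈) }
  step-climbing-b r (x ∷ xs) 1≤k (h , _) =
    step (falling r (false ∷ xs)) h
         (s≤s (*-monoʳ-≤ (2 ^ suc r) (+-monoˡ-≤ (2 * value xs) (bit≤1 x)))) back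
    where
    back : Back (climbing r (x ∷ xs)) b (falling r (false ∷ xs))
    back (inj₁ s′∈)         = map₂ (map₁ inj₁) (carries-b⁻¹ 0 (suc r) s′∈)
    back (inj₂ (inj₁ refl)) = cell x 0 , inj₂ (inj₁ refl) , goto-edge (b-bottom x 1≤k)
    back (inj₂ (inj₂ s′∈))  =
      map₂ (map₁ (inj₂ ∘ inj₂))
           (cells-b⁻¹ 0 xs (≤-trans (m≤n+m (suc (length xs)) (suc r)) h) s′∈)

  step-falling-a : ∀ r xs → 1 ≤ k → Fits (falling r xs) → Step (falling r xs) a
  step-falling-a r xs 1≤k fits = reset-step 1≤k fits (inj₁ (0 , s≤s z≤n , refl)) refl

  step-falling-b : ∀ r xs → 1 ≤ k → Fits (falling r xs) → Step (falling r xs) b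
  step-falling-b zero xs 1≤k h =
    step (cells 1 (true ∷ xs)) (h , s≤s h) (≤-trans (≤-reflexive (*-suc 2 (value xs))) (n≤1+n _)) back
    where
    back : Back (falling 0 xs) b (cells 1 (true ∷ xs))
    back (inj₁ refl) = carry 0 , inj₁ (0 , s≤s z≤n , refl) , goto-edge refl
    back (inj₂ s′∈)  = map₂ (map₁ inj₂) (cells-b⁻¹ 0 xs h s′∈)
  step-falling-b (suc r) xs 1≤k h =
    step (falling r (true ∷ xs)) (subst (_≤ k) (sym (+-suc (suc r) (length xs))) h) pot≤ back
    where
    pot≤ : 2 ^ suc (suc r) * suc (value xs) ≤ suc (2 ^ suc r * suc (suc (2 * value xs)))
    pot≤ = ≤-trans (≤-reflexive (trans (cong (_* suc (value xs)) (*-comm 2 (2 ^ suc r)))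
                                 (trans (*-assoc (2 ^ suc r) 2 (suc (value xs)))
                                        (cong (2 ^ suc r *_) (*-suc 2 (value xs))))))
                   (n≤1+n _)

    back : Back (falling (suc r) xs) b (falling r (true ∷ xs))
    back (inj₁ (i , i<1+r , refl)) = carry (suc i) , inj₁ (suc i , s≤s i<1+r , refl) , goto-edge refl
    back (inj₂ (inj₁ refl))        = carry 0 , inj₁ (0 , s≤s z≤n , refl) , goto-edge refl
    back (inj₂ (inj₂ s′∈))         =
      map₂ (map₁ inj₂) (cells-b⁻¹ 0 xs (≤-trans (s≤s (m≤n+m (length xs) (suc r))) h) s′∈)

  step-carries-a : ∀ r t → 1 ≤ k → Fits (carries r t) → Step (carries r t) a
  step-carries-a r t 1≤k fits with suc (suc (suc (t + r))) <? k
  ... | no  top≮k = reset-step 1≤k fits (r , ≤-refl , refl) (a-carry-reset top≮k)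
  ... | yes top<k =
    step (carries r (suc t)) top<k (n≤1+n 1)
         (carries-a⁻¹ (suc t) (suc r) (subst (_< k) (cong (suc ∘ suc) (sym (+-suc t r))) top<k))

  step-carries-b : ∀ r t → 1 ≤ k → Fits (carries r t) → Step (carries r t) b
  step-carries-b r zero 1≤k h =
    step (climbing r []) (subst (_≤ k) (sym (+-identityʳ (suc r))) (<⇒≤ 1+r<k) , 1+r<k) (s≤s z≤n)
         λ { (inj₁ s′∈) → carries-b⁻¹ 1 (suc r) s′∈ }
    where
    1+r<k : suc r < k
    1+r<k = ≤-trans (n≤1+n _) h
  step-carries-b r (suc t) 1≤k h =
    step (carries r t) (≤-trans (n≤1+n _) h) (n≤1+n 1) (carries-b⁻¹ (suc (suc t)) (suc r))

  step-exists : ∀ c x → 1 ≤ k → Fits c → Step c x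
  step-exists (cells e xs)    a = step-cells-a e xs
  step-exists (cells e xs)    b = step-cells-b e xs
  step-exists (climbing r xs) a = step-climbing-a r xs
  step-exists (climbing r xs) b = step-climbing-b r xs
  step-exists (falling r xs)  a = step-falling-a r xs
  step-exists (falling r xs)  b = step-falling-b r xs
  step-exists (carries r t)   a = step-carries-a r t
  step-exists (carries r t)   b = step-carries-b r t

  Live : Σ Config Fits → Fin (size k) → Set
  Live (c , _) q = Mem c (decode q)

  live-inhabited : ∀ cf → 0 < pot (proj₁ cf) → ∃ (Live cf)
  live-inhabited (c , fits) 0<pot with Mem-inhabited c 0<pot
  ... | s , s∈ with encode-valid (Mem-valid c fits s∈)
  ...   | q , refl = q , s∈

  live-step : 1 ≤ k → ∀ cf x → ∃ λ cf′ → pot (proj₁ cf) ≤ suc (pot (proj₁ cf′)) ×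
                (∀ {q′} → Live cf′ q′ → ∃ λ q → Live cf q × δ automaton q x q′ ≡ true)
  live-step 1≤k (c , fits) x with step-exists c x 1≤k fits
  ... | step c′ fits′ pot≤ back = (c′ , fits′) , pot≤ , λ {q′} → pullback {q′}
    where
    pullback : ∀ {q′} → Mem c′ (decode q′) →
               ∃ λ q → Mem c (decode q) × δ automaton q x q′ ≡ true
    pullback {q′} q′∈ with back {decode q′} q′∈
    ... | s , s∈ , edge with encode-valid (Mem-valid c fits s∈)
    ...   | q , refl = q , s∈ , edge⇒δ q x q′ edge

  2^k≤mortal : 1 ≤ k → ∀ w → Mortal automaton w → 2 ^ k ≤ length w
  2^k≤mortal 1≤k w mortal =
    subst (_≤ length w) (pot-ones 1≤k)
          (PotentialLowerBound.pot≤mortal automaton Live (pot ∘ proj₁) live-inhabited (live-step 1≤k)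
                                          (ones , ones-fits) w mortal)

shortest-mortal-2^k : ∀ k → 1 ≤ k → ShortestMortalAtLeast (Counter.automaton k) (2 ^ k)
shortest-mortal-2^k k 1≤k =
  (Counter.mortalWord k , Counter.mortalWord-mortal k 1≤k) , CounterLowerBound.2^k≤mortal k 1≤k

size≡3k+2 : ∀ k → suc k + (suc k + k) ≡ 3 * k + 2
size≡3k+2 = solve-∀

theorem6 : (n k : ℕ) → n ≡ 3 * k + 2 → 5 ≤ n →
    ∃ λ (A : NFA n 2) → ShortestMortalAtLeast A (2 ^ k)
theorem6 _ zero    refl (s≤s (s≤s ()))
theorem6 _ (suc k) refl _ =
  subst (λ n → ∃ λ (A : NFA n 2) → ShortestMortalAtLeast A (2 ^ suc k)) (size≡3k+2 (suc k))
        (Counter.automaton (suc k) , shortest-mortal-2^k (suc k) (s≤s z≤n))
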